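{- Let $G$ be a strong bicentral $2$-tree with tail set $\{2,3\}$ on $n\ge 4$ vertices with maximum degree $\Delta$. Then $\lceil (n+2)/2\rceil\le\Delta\le n-1$, and the numbers $x$ and $y$ of tail vertices of degree $3$ and of degree $2$ are given by $x=2(n-1-\Delta)$ and $y=2\Delta-n$.
   Context: A $2$-tree is a graph obtained from the triangle $K_3$ by repeatedly adding a new vertex adjacent to both endpoints of an existing edge. For $r\in\{1,2,3\}$ and an integer $\Delta\ge 2$, a $2$-tree on $n$ vertices is $r$-central with maximum degree $\Delta$ if $\Delta$ is its maximum degree and exactly $r$ vertices have degree $\Delta$; these $r$ vertices form the core and the other $n-r$ vertices form the tail. It is strong if the core induces $K_r$. It has tail set $\{2,3\}$ if every tail vertex has degree $2$ or $3$. "Bicentral" means $2$-central. -}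

module Defs where

open import Data.Nat using (ℕ; zero; suc; _≤_; _≟_)
open import Data.Fin using (Fin; zero; suc)
import Data.Fin as F
open import Data.Bool using (Bool; true; false; _∨_; if_then_else_)
open import Data.List using (List; length; filter; allFin; map)
open import Data.Nat.ListAction using (sum)
open import Data.Product using (Σ; ∃; _×_; _,_)
open import Data.Sum using (_⊎_)
open import Relation.Nullary using (¬_; ⌊_⌋; ¬?)
open import Relation.Nullary.Decidable using (_×-dec_)
open import Relation.Binary.PropositionalEquality using (_≡_; _≢_)
open import Function.Bundles using (_↔_; Inverse)

Graph : ℕ → Set
Graph n = Fin n → Fin n → Bool

K3 : Graph 3
K3 i j = if ⌊ i F.≟ j ⌋ then false else true

-- Add a new vertex (labelled zero; old vertices shifted by suc) adjacent
-- exactly to u and v.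
extend : ∀ {n} → Graph n → Fin n → Fin n → Graph (suc n)
extend G u v zero    zero    = false
extend G u v zero    (suc j) = ⌊ j F.≟ u ⌋ ∨ ⌊ j F.≟ v ⌋
extend G u v (suc i) zero    = ⌊ i F.≟ u ⌋ ∨ ⌊ i F.≟ v ⌋
extend G u v (suc i) (suc j) = G i j

relabelG : ∀ {n} → (Fin n ↔ Fin n) → Graph n → Graph n
relabelG σ G i j = G (Inverse.to σ i) (Inverse.to σ j)

-- 2-trees: obtained from K₃ by repeatedly adding a vertex adjacent to both
-- endpoints of an existing edge (closed under relabelling, i.e. taken up to
-- isomorphism).
data Is2Tree : (n : ℕ) → Graph n → Set where
  triangle : Is2Tree 3 K3
  addVertex : ∀ {n G} → Is2Tree n G → (u v : Fin n) → G u v ≡ true →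
              Is2Tree (suc n) (extend G u v)
  relabel : ∀ {n G} → Is2Tree n G → (σ : Fin n ↔ Fin n) →
            Is2Tree n (relabelG σ G)

deg : ∀ {n} → Graph n → Fin n → ℕ
deg {n} G v = sum (map (λ j → if G v j then 1 else 0) (allFin n))

MaxDegree : ∀ {n} → Graph n → ℕ → Set
MaxDegree {n} G Δ = (∀ v → deg G v ≤ Δ) × ∃ λ v → deg G v ≡ Δ

-- G is strong bicentral with maximum degree Δ: Δ is the maximum degree,
-- exactly two vertices a ≠ b have degree Δ (the core), and they are adjacent
-- (the core induces K₂).
StrongBicentral : ∀ {n} → Graph n → ℕ → Set
StrongBicentral {n} G Δ =
  MaxDegree G Δ ×
  Σ (Fin n) λ a → Σ (Fin n) λ b →
    a ≢ b × deg G a ≡ Δ × deg G b ≡ Δ ×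
    (∀ v → deg G v ≡ Δ → v ≡ a ⊎ v ≡ b) ×
    G a b ≡ true

-- Tail vertices are those of degree ≠ Δ; tail set {2,3}.
TailSet23 : ∀ {n} → Graph n → ℕ → Set
TailSet23 {n} G Δ = ∀ v → deg G v ≢ Δ → deg G v ≡ 2 ⊎ deg G v ≡ 3

tailCount : ∀ {n} → Graph n → ℕ → ℕ → ℕ
tailCount {n} G Δ d =
  length (filter (λ v → ¬? (deg G v ≟ Δ) ×-dec (deg G v ≟ d)) (allFin n))

{-# OPTIONS --safe #-}
-- Counting vertices by class and summing degrees gives n = 2 + x + y and
-- 2Δ + 3x + 2y = 2|E| = 4n − 6, since a 2-tree on n vertices has 2n − 3 edges.
-- These force x = 2h and Δ = 1 + h + y for some h, from which every claim
-- follows, the lower bound on Δ being equivalent to y ≥ 2. That last fact comes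
-- from the structure of 2-trees: for n ≥ 4 there are two non-adjacent vertices
-- of degree 2, and neither lies in the core, since having equal degree they
-- would both lie there, whereas the two core vertices are adjacent.
module Submission where

open import Defs
open import Data.Bool using (Bool; true; false; _∨_; if_then_else_)
open import Data.Empty using (⊥-elim)
open import Data.Fin using (Fin; zero; suc)
import Data.Fin as F
open import Data.List using (List; []; _∷_; length; filter; map; tabulate; allFin)
import Data.Nat.ListAction as List
open import Data.Nat using (ℕ; zero; suc; _≤_; _<_; _≟_; _+_; _*_; _∸_; z≤n; s≤s; ⌈_/2⌉)
open import Data.Nat.Properties
open import Data.Nat.Tactic.RingSolver using (solve)
open import Data.Product using (∃; ∃₂; ∃-syntax; _×_; _,_; proj₁; proj₂)
open import Data.Sum using (_⊎_; inj₁; inj₂; [_,_])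
open import Function using (_∘_; id)
open import Function.Bundles using (_↔_; Inverse)
open import Relation.Nullary using (⌊_⌋; ¬?; yes; no; does)
open import Relation.Nullary.Decidable using (_×-dec_; dec-true; dec-false; ⌊⌋-map′)
open import Relation.Unary using (Pred; Decidable)
open import Relation.Binary.PropositionalEquality hiding ([_])
open import Algebra.Properties.Semiring.Sum +-*-semiring
  using (sum; sum-syntax; sum-cong-≗; sum-replicate-zero; ∑-distrib-+; *-distribˡ-sum; ∑-permute)

𝟙[_] : Bool → ℕ
𝟙[ b ] = if b then 1 else 0

sum-map-tabulate : ∀ {a} {A : Set a} {n} (f : A → ℕ) (g : Fin n → A) →
  List.sum (map f (tabulate g)) ≡ ∑[ i < n ] f (g i)
sum-map-tabulate {n = zero}  f g = refl
sum-map-tabulate {n = suc n} f g = cong (f (g zero) +_) (sum-map-tabulate f (g ∘ suc))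

length-filter≡sum-map : ∀ {a p} {A : Set a} {P : Pred A p} (P? : Decidable P) (xs : List A) →
  length (filter P? xs) ≡ List.sum (map (λ x → 𝟙[ does (P? x) ]) xs)
length-filter≡sum-map P? [] = refl
length-filter≡sum-map P? (x ∷ xs) with does (P? x)
... | true  = cong suc (length-filter≡sum-map P? xs)
... | false = length-filter≡sum-map P? xs

length-filter-allFin : ∀ {n p} {P : Pred (Fin n) p} (P? : Decidable P) →
  length (filter P? (allFin n)) ≡ ∑[ i < n ] 𝟙[ does (P? i) ]
length-filter-allFin {n} P? =
  trans (length-filter≡sum-map P? (allFin n)) (sum-map-tabulate (λ i → 𝟙[ does (P? i) ]) id)

∑-const-1 : ∀ n → ∑[ i < n ] 1 ≡ n
∑-const-1 zero    = refl
∑-const-1 (suc n) = cong suc (∑-const-1 n)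

∑-mono : ∀ {n} {f g : Fin n → ℕ} → (∀ i → f i ≤ g i) → ∑[ i < n ] f i ≤ ∑[ i < n ] g i
∑-mono {zero}  f≤g = z≤n
∑-mono {suc n} f≤g = +-mono-≤ (f≤g zero) (∑-mono (f≤g ∘ suc))

∑-+₃ : ∀ {n} (f g h : Fin n → ℕ) →
  ∑[ i < n ] (f i + g i + h i) ≡ ∑[ i < n ] f i + ∑[ i < n ] g i + ∑[ i < n ] h i
∑-+₃ f g h = trans (∑-distrib-+ (λ i → f i + g i) h) (cong (_+ sum h) (∑-distrib-+ f g))

∑-δ : ∀ {n} (u : Fin n) → ∑[ j < n ] 𝟙[ ⌊ j F.≟ u ⌋ ] ≡ 1
∑-δ {suc n} zero    = cong suc (sum-replicate-zero n)
∑-δ {suc n} (suc u) = trans (sum-cong-≗ λ j → cong 𝟙[_] (⌊⌋-map′ _ _ (j F.≟ u))) (∑-δ u)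

∑-δ-pair : ∀ {n} {u v : Fin n} → u ≢ v → ∑[ j < n ] 𝟙[ ⌊ j F.≟ u ⌋ ∨ ⌊ j F.≟ v ⌋ ] ≡ 2
∑-δ-pair {n} {u} {v} u≢v = begin
  ∑[ j < n ] 𝟙[ ⌊ j F.≟ u ⌋ ∨ ⌊ j F.≟ v ⌋ ]      ≡⟨ sum-cong-≗ split ⟩
  ∑[ j < n ] (δ u j + δ v j)                     ≡⟨ ∑-distrib-+ (δ u) (δ v) ⟩
  ∑[ j < n ] δ u j + ∑[ j < n ] δ v j            ≡⟨ cong₂ _+_ (∑-δ u) (∑-δ v) ⟩
  2                                              ∎
  where
  open ≡-Reasoning
  δ : Fin n → Fin n → ℕ
  δ w j = 𝟙[ ⌊ j F.≟ w ⌋ ]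
  split : ∀ j → 𝟙[ ⌊ j F.≟ u ⌋ ∨ ⌊ j F.≟ v ⌋ ] ≡ δ u j + δ v j
  split j with j F.≟ u | j F.≟ v
  ... | yes refl | yes refl = ⊥-elim (u≢v refl)
  ... | yes _    | no _     = refl
  ... | no _     | _        = refl

2≤∑ : ∀ {n} {f : Fin n → ℕ} {c d : Fin n} → c ≢ d → 1 ≤ f c → 1 ≤ f d → 2 ≤ ∑[ i < n ] f i
2≤∑ {f = f} {c} {d} c≢d 1≤fc 1≤fd = subst (_≤ sum f) (∑-δ-pair c≢d) (∑-mono below)
  where
  below : ∀ i → 𝟙[ ⌊ i F.≟ c ⌋ ∨ ⌊ i F.≟ d ⌋ ] ≤ f i
  below i with i F.≟ c | i F.≟ d
  ... | yes refl | _        = 1≤fc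
  ... | no _     | yes refl = 1≤fd
  ... | no _     | no _     = z≤n

Loopless : ∀ {n} → Graph n → Set
Loopless G = ∀ i → G i i ≡ false

Undirected : ∀ {n} → Graph n → Set
Undirected G = ∀ i j → G i j ≡ G j i

edge⇒distinct : ∀ {n} {G : Graph n} {u v} → Loopless G → G u v ≡ true → u ≢ v
edge⇒distinct {u = u} loopless uv refl with trans (sym (loopless u)) uv
... | ()

≟-∨-true : ∀ {n} {j u v : Fin n} → ⌊ j F.≟ u ⌋ ∨ ⌊ j F.≟ v ⌋ ≡ true → j ≡ u ⊎ j ≡ v
≟-∨-true {j = j} {u} {v} e with j F.≟ u | j F.≟ v
... | yes j≡u | _       = inj₁ j≡u
... | no _    | yes j≡v = inj₂ j≡v

≟-∨-false : ∀ {n} {j u v : Fin n} → j ≢ u → j ≢ v → ⌊ j F.≟ u ⌋ ∨ ⌊ j F.≟ v ⌋ ≡ false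
≟-∨-false {j = j} {u} {v} j≢u j≢v with j F.≟ u | j F.≟ v
... | yes j≡u | _       = ⊥-elim (j≢u j≡u)
... | no _    | yes j≡v = ⊥-elim (j≢v j≡v)
... | no _    | no _    = refl

deg≡∑ : ∀ {n} (G : Graph n) v → deg G v ≡ ∑[ j < n ] 𝟙[ G v j ]
deg≡∑ G v = sum-map-tabulate (λ j → 𝟙[ G v j ]) id

deg-extend-new : ∀ {n} (G : Graph n) {u v} → u ≢ v → deg (extend G u v) zero ≡ 2
deg-extend-new G u≢v = trans (deg≡∑ (extend G _ _) zero) (∑-δ-pair u≢v)

deg-extend-old : ∀ {n} (G : Graph n) u v i →
  deg (extend G u v) (suc i) ≡ 𝟙[ ⌊ i F.≟ u ⌋ ∨ ⌊ i F.≟ v ⌋ ] + deg G i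
deg-extend-old G u v i = trans (deg≡∑ (extend G u v) (suc i)) (cong (_ +_) (sym (deg≡∑ G i)))

deg-extend-other : ∀ {n} (G : Graph n) {u v i} → i ≢ u → i ≢ v → deg (extend G u v) (suc i) ≡ deg G i
deg-extend-other G {u} {v} {i} i≢u i≢v =
  trans (deg-extend-old G u v i) (cong (λ b → 𝟙[ b ] + deg G i) (≟-∨-false i≢u i≢v))

-- The invariant behind NonadjacentDegree2Pair: once a vertex z is attached to
-- an edge uv, z and a degree-2 vertex off uv are non-adjacent of degree 2.
Degree2OffEveryEdge : ∀ {n} → Graph n → Set
Degree2OffEveryEdge G = ∀ u v → G u v ≡ true → ∃[ w ] w ≢ u × w ≢ v × deg G w ≡ 2

NonadjacentDegree2Pair : ∀ {n} → Graph n → Set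
NonadjacentDegree2Pair G = ∃₂ λ c d → c ≢ d × G c d ≡ false × deg G c ≡ 2 × deg G d ≡ 2

K3-degree2-off-every-edge : Degree2OffEveryEdge K3
K3-degree2-off-every-edge zero             zero             ()
K3-degree2-off-every-edge zero             (suc zero)       _ = suc (suc zero) , (λ ()) , (λ ()) , refl
K3-degree2-off-every-edge zero             (suc (suc zero)) _ = suc zero , (λ ()) , (λ ()) , refl
K3-degree2-off-every-edge (suc zero)       zero             _ = suc (suc zero) , (λ ()) , (λ ()) , refl
K3-degree2-off-every-edge (suc zero)       (suc zero)       ()
K3-degree2-off-every-edge (suc zero)       (suc (suc zero)) _ = zero , (λ ()) , (λ ()) , refl
K3-degree2-off-every-edge (suc (suc zero)) zero             _ = suc zero , (λ ()) , (λ ()) , refl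
K3-degree2-off-every-edge (suc (suc zero)) (suc zero)       _ = zero , (λ ()) , (λ ()) , refl
K3-degree2-off-every-edge (suc (suc zero)) (suc (suc zero)) ()

module _ {n} {G : Graph n} {u v : Fin n} (loopless : Loopless G) (uv : G u v ≡ true) where

  private
    u≢v : u ≢ v
    u≢v = edge⇒distinct loopless uv

  extend-degree-sum : ∑[ i < n ] deg G i + 6 ≡ 4 * n →
                      ∑[ i < suc n ] deg (extend G u v) i + 6 ≡ 4 * suc n
  extend-degree-sum handshake = begin
    deg (extend G u v) zero + ∑[ i < n ] deg (extend G u v) (suc i) + 6
      ≡⟨ cong₂ (λ a b → a + b + 6) (deg-extend-new G u≢v) (sum-cong-≗ (deg-extend-old G u v)) ⟩
    2 + ∑[ i < n ] (𝟙[ ⌊ i F.≟ u ⌋ ∨ ⌊ i F.≟ v ⌋ ] + deg G i) + 6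
      ≡⟨ cong (λ s → 2 + s + 6) (∑-distrib-+ _ (deg G)) ⟩
    2 + (∑[ i < n ] 𝟙[ ⌊ i F.≟ u ⌋ ∨ ⌊ i F.≟ v ⌋ ] + sum (deg G)) + 6
      ≡⟨ cong (λ s → 2 + (s + sum (deg G)) + 6) (∑-δ-pair u≢v) ⟩
    2 + (2 + sum (deg G)) + 6
      ≡⟨⟩
    4 + (sum (deg G) + 6)
      ≡⟨ cong (4 +_) handshake ⟩
    4 + 4 * n
      ≡⟨ *-suc 4 n ⟨
    4 * suc n ∎
    where open ≡-Reasoning

  extend-degree2-off-every-edge : Degree2OffEveryEdge G → Degree2OffEveryEdge (extend G u v)
  extend-degree2-off-every-edge off with off u v uv
  ... | w , w≢u , w≢v , deg-w = off′
    where
    deg-suc-w : deg (extend G u v) (suc w) ≡ 2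
    deg-suc-w = trans (deg-extend-other G w≢u w≢v) deg-w
    misses : ∀ j → ⌊ j F.≟ u ⌋ ∨ ⌊ j F.≟ v ⌋ ≡ true → suc w ≢ suc j
    misses j e refl = [ w≢u , w≢v ] (≟-∨-true e)
    off′ : Degree2OffEveryEdge (extend G u v)
    off′ zero    zero    ()
    off′ zero    (suc j) e = suc w , (λ ()) , misses j e , deg-suc-w
    off′ (suc i) zero    e = suc w , misses i e , (λ ()) , deg-suc-w
    off′ (suc i) (suc j) e = zero , (λ ()) , (λ ()) , deg-extend-new G u≢v

  extend-nonadjacent-degree2-pair : Degree2OffEveryEdge G → NonadjacentDegree2Pair (extend G u v)
  extend-nonadjacent-degree2-pair off with off u v uv
  ... | w , w≢u , w≢v , deg-w =
    zero , suc w , (λ ()) , ≟-∨-false w≢u w≢v ,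
    deg-extend-new G u≢v , trans (deg-extend-other G w≢u w≢v) deg-w

module _ {n} {G : Graph n} (σ : Fin n ↔ Fin n) where

  open Inverse σ using (to; from; strictlyInverseˡ)

  private
    from-≢ : ∀ {i j} → i ≢ j → from i ≢ from j
    from-≢ i≢j e = i≢j (trans (sym (strictlyInverseˡ _)) (trans (cong to e) (strictlyInverseˡ _)))

    to-from-≢ : ∀ {i j} → i ≢ to j → from i ≢ j
    to-from-≢ i≢j refl = i≢j (sym (strictlyInverseˡ _))

  deg-relabel : ∀ i → deg (relabelG σ G) i ≡ deg G (to i)
  deg-relabel i = begin
    deg (relabelG σ G) i                ≡⟨ deg≡∑ (relabelG σ G) i ⟩
    ∑[ j < n ] 𝟙[ G (to i) (to j) ]     ≡⟨ ∑-permute (λ j → 𝟙[ G (to i) j ]) σ ⟨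
    ∑[ j < n ] 𝟙[ G (to i) j ]          ≡⟨ deg≡∑ G (to i) ⟨
    deg G (to i)                        ∎
    where open ≡-Reasoning

  deg-relabel-from : ∀ {i d} → deg G i ≡ d → deg (relabelG σ G) (from i) ≡ d
  deg-relabel-from {i} deg-i =
    trans (deg-relabel (from i)) (trans (cong (deg G) (strictlyInverseˡ i)) deg-i)

  relabel-degree-sum : ∑[ i < n ] deg G i + 6 ≡ 4 * n → ∑[ i < n ] deg (relabelG σ G) i + 6 ≡ 4 * n
  relabel-degree-sum handshake =
    trans (cong (_+ 6) (trans (sum-cong-≗ deg-relabel) (sym (∑-permute (deg G) σ)))) handshake

  relabel-degree2-off-every-edge : Degree2OffEveryEdge G → Degree2OffEveryEdge (relabelG σ G)
  relabel-degree2-off-every-edge off i j e with off (to i) (to j) e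
  ... | w , w≢i , w≢j , deg-w = from w , to-from-≢ w≢i , to-from-≢ w≢j , deg-relabel-from deg-w

  relabel-nonadjacent-degree2-pair : NonadjacentDegree2Pair G → NonadjacentDegree2Pair (relabelG σ G)
  relabel-nonadjacent-degree2-pair (c , d , c≢d , cd , deg-c , deg-d) =
    from c , from d , from-≢ c≢d ,
    trans (cong₂ G (strictlyInverseˡ c) (strictlyInverseˡ d)) cd ,
    deg-relabel-from deg-c , deg-relabel-from deg-d

Is2Tree⇒loopless : ∀ {n G} → Is2Tree n G → Loopless G
Is2Tree⇒loopless triangle zero             = refl
Is2Tree⇒loopless triangle (suc zero)       = refl
Is2Tree⇒loopless triangle (suc (suc zero)) = refl
Is2Tree⇒loopless (addVertex T _ _ _) zero    = refl
Is2Tree⇒loopless (addVertex T _ _ _) (suc i) = Is2Tree⇒loopless T i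
Is2Tree⇒loopless (relabel T σ) i = Is2Tree⇒loopless T (Inverse.to σ i)

Is2Tree⇒undirected : ∀ {n G} → Is2Tree n G → Undirected G
Is2Tree⇒undirected triangle i j with i F.≟ j | j F.≟ i
... | yes _    | yes _    = refl
... | no _     | no _     = refl
... | yes refl | no j≢i   = ⊥-elim (j≢i refl)
... | no i≢j   | yes refl = ⊥-elim (i≢j refl)
Is2Tree⇒undirected (addVertex T _ _ _) zero    zero    = refl
Is2Tree⇒undirected (addVertex T _ _ _) zero    (suc j) = refl
Is2Tree⇒undirected (addVertex T _ _ _) (suc i) zero    = refl
Is2Tree⇒undirected (addVertex T _ _ _) (suc i) (suc j) = Is2Tree⇒undirected T i j
Is2Tree⇒undirected (relabel T σ) i j = Is2Tree⇒undirected T (Inverse.to σ i) (Inverse.to σ j)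

Is2Tree⇒degree-sum : ∀ {n G} → Is2Tree n G → ∑[ i < n ] deg G i + 6 ≡ 4 * n
Is2Tree⇒degree-sum triangle             = refl
Is2Tree⇒degree-sum (addVertex T _ _ uv) =
  extend-degree-sum (Is2Tree⇒loopless T) uv (Is2Tree⇒degree-sum T)
Is2Tree⇒degree-sum (relabel T σ) = relabel-degree-sum σ (Is2Tree⇒degree-sum T)

Is2Tree⇒degree2-off-every-edge : ∀ {n G} → Is2Tree n G → Degree2OffEveryEdge G
Is2Tree⇒degree2-off-every-edge triangle = K3-degree2-off-every-edge
Is2Tree⇒degree2-off-every-edge (addVertex T _ _ uv) =
  extend-degree2-off-every-edge (Is2Tree⇒loopless T) uv (Is2Tree⇒degree2-off-every-edge T)
Is2Tree⇒degree2-off-every-edge (relabel T σ) =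
  relabel-degree2-off-every-edge σ (Is2Tree⇒degree2-off-every-edge T)

Is2Tree⇒nonadjacent-degree2-pair : ∀ {n G} → Is2Tree n G → 4 ≤ n → NonadjacentDegree2Pair G
Is2Tree⇒nonadjacent-degree2-pair triangle (s≤s (s≤s (s≤s ())))
Is2Tree⇒nonadjacent-degree2-pair (addVertex T _ _ uv) _ =
  extend-nonadjacent-degree2-pair (Is2Tree⇒loopless T) uv (Is2Tree⇒degree2-off-every-edge T)
Is2Tree⇒nonadjacent-degree2-pair (relabel T σ) 4≤n =
  relabel-nonadjacent-degree2-pair σ (Is2Tree⇒nonadjacent-degree2-pair T 4≤n)

module _ (Δ : ℕ) where

  inCore : ℕ → ℕ
  inCore k = 𝟙[ does (k ≟ Δ) ]

  inTail : ℕ → ℕ → ℕ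
  inTail d k = 𝟙[ does (¬? (k ≟ Δ) ×-dec (k ≟ d)) ]

  inCore-yes : ∀ {k} → k ≡ Δ → inCore k ≡ 1
  inCore-yes {k} k≡Δ = cong 𝟙[_] (dec-true (k ≟ Δ) k≡Δ)

  inCore-no : ∀ {k} → k ≢ Δ → inCore k ≡ 0
  inCore-no {k} k≢Δ = cong 𝟙[_] (dec-false (k ≟ Δ) k≢Δ)

  inTail-yes : ∀ {d k} → k ≢ Δ → k ≡ d → inTail d k ≡ 1
  inTail-yes {d} {k} k≢Δ k≡d = cong 𝟙[_] (dec-true (¬? (k ≟ Δ) ×-dec (k ≟ d)) (k≢Δ , k≡d))

  inTail-core : ∀ {d k} → k ≡ Δ → inTail d k ≡ 0
  inTail-core {d} {k} k≡Δ = cong 𝟙[_] (dec-false (¬? (k ≟ Δ) ×-dec (k ≟ d)) λ (k≢Δ , _) → k≢Δ k≡Δ)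

  inTail-other : ∀ {d k} → k ≢ d → inTail d k ≡ 0
  inTail-other {d} {k} k≢d = cong 𝟙[_] (dec-false (¬? (k ≟ Δ) ×-dec (k ≟ d)) λ (_ , k≡d) → k≢d k≡d)

  degree-classes : ∀ k → (k ≢ Δ → k ≡ 2 ⊎ k ≡ 3) →
    1 ≡ inCore k + inTail 3 k + inTail 2 k ×
    k ≡ Δ * inCore k + 3 * inTail 3 k + 2 * inTail 2 k
  degree-classes k tail23 with k ≟ Δ
  ... | yes k≡Δ rewrite inCore-yes k≡Δ | inTail-core {3} k≡Δ | inTail-core {2} k≡Δ =
    refl , trans k≡Δ (solve (Δ ∷ []))
  ... | no k≢Δ with tail23 k≢Δ
  ...   | inj₁ k≡2
    rewrite inCore-no k≢Δ | inTail-other {3} (subst (_≢ 3) (sym k≡2) λ ()) | inTail-yes k≢Δ k≡2 =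
    refl , trans k≡2 (solve (Δ ∷ []))
  ...   | inj₂ k≡3
    rewrite inCore-no k≢Δ | inTail-yes k≢Δ k≡3 | inTail-other {2} (subst (_≢ 2) (sym k≡3) λ ()) =
    refl , trans k≡3 (solve (Δ ∷ []))

tailCount≡∑ : ∀ {n} (G : Graph n) Δ d → tailCount G Δ d ≡ ∑[ v < n ] inTail Δ d (deg G v)
tailCount≡∑ G Δ d = length-filter-allFin (λ v → ¬? (deg G v ≟ Δ) ×-dec (deg G v ≟ d))

module _ {n} {G : Graph n} {Δ : ℕ} where

  core-count : StrongBicentral G Δ → ∑[ v < n ] inCore Δ (deg G v) ≡ 2
  core-count (_ , a , b , a≢b , deg-a , deg-b , core⊆ab , _) =
    trans (sum-cong-≗ indicator) (∑-δ-pair a≢b)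
    where
    indicator : ∀ v → inCore Δ (deg G v) ≡ 𝟙[ ⌊ v F.≟ a ⌋ ∨ ⌊ v F.≟ b ⌋ ]
    indicator v with v F.≟ a | v F.≟ b
    ... | yes refl | _        = inCore-yes Δ deg-a
    ... | no _     | yes refl = inCore-yes Δ deg-b
    ... | no v≢a   | no v≢b   = inCore-no Δ λ deg-v → [ v≢a , v≢b ] (core⊆ab v deg-v)

  core-vertices-adjacent : Undirected G → StrongBicentral G Δ →
    ∀ {c d} → c ≢ d → deg G c ≡ Δ → deg G d ≡ Δ → G c d ≡ true
  core-vertices-adjacent undirected (_ , a , b , _ , _ , _ , core⊆ab , ab) {c} {d} c≢d deg-c deg-d
    with core⊆ab c deg-c | core⊆ab d deg-d
  ... | inj₁ refl | inj₁ refl = ⊥-elim (c≢d refl)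
  ... | inj₁ refl | inj₂ refl = ab
  ... | inj₂ refl | inj₁ refl = trans (undirected b a) ab
  ... | inj₂ refl | inj₂ refl = ⊥-elim (c≢d refl)

  module _ (bicentral : StrongBicentral G Δ) (tails : TailSet23 G Δ) where

    private
      core : Fin n → ℕ
      core v = inCore Δ (deg G v)

      tail : ℕ → Fin n → ℕ
      tail d v = inTail Δ d (deg G v)

      counts : (f : ℕ → ℕ → ℕ → ℕ) →
        f (sum core) (sum (tail 3)) (sum (tail 2)) ≡ f 2 (tailCount G Δ 3) (tailCount G Δ 2)
      counts f = trans (cong (λ s → f s (sum (tail 3)) (sum (tail 2))) (core-count bicentral))
                       (sym (cong₂ (f 2) (tailCount≡∑ G Δ 3) (tailCount≡∑ G Δ 2)))

    vertex-count : n ≡ 2 + tailCount G Δ 3 + tailCount G Δ 2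
    vertex-count = begin
      n
        ≡⟨ ∑-const-1 n ⟨
      ∑[ v < n ] 1
        ≡⟨ sum-cong-≗ (λ v → proj₁ (degree-classes Δ (deg G v) (tails v))) ⟩
      ∑[ v < n ] (core v + tail 3 v + tail 2 v)
        ≡⟨ ∑-+₃ core (tail 3) (tail 2) ⟩
      sum core + sum (tail 3) + sum (tail 2)
        ≡⟨ counts (λ p q r → p + q + r) ⟩
      2 + tailCount G Δ 3 + tailCount G Δ 2 ∎
      where open ≡-Reasoning

    degree-sum : ∑[ v < n ] deg G v ≡ Δ * 2 + 3 * tailCount G Δ 3 + 2 * tailCount G Δ 2
    degree-sum = begin
      ∑[ v < n ] deg G v
        ≡⟨ sum-cong-≗ (λ v → proj₂ (degree-classes Δ (deg G v) (tails v))) ⟩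
      ∑[ v < n ] (Δ * core v + 3 * tail 3 v + 2 * tail 2 v)
        ≡⟨ ∑-+₃ (λ v → Δ * core v) (λ v → 3 * tail 3 v) (λ v → 2 * tail 2 v) ⟩
      ∑[ v < n ] (Δ * core v) + ∑[ v < n ] (3 * tail 3 v) + ∑[ v < n ] (2 * tail 2 v)
        ≡⟨ cong₂ _+_ (cong₂ _+_ (*-distribˡ-sum Δ core) (*-distribˡ-sum 3 (tail 3)))
                     (*-distribˡ-sum 2 (tail 2)) ⟨
      Δ * sum core + 3 * sum (tail 3) + 2 * sum (tail 2)
        ≡⟨ counts (λ p q r → Δ * p + 3 * q + 2 * r) ⟩
      Δ * 2 + 3 * tailCount G Δ 3 + 2 * tailCount G Δ 2 ∎
      where open ≡-Reasoning

  2≤tailCount-2 : Is2Tree n G → 4 ≤ n → StrongBicentral G Δ → 2 ≤ tailCount G Δ 2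
  2≤tailCount-2 T 4≤n bicentral with Is2Tree⇒nonadjacent-degree2-pair T 4≤n
  ... | c , d , c≢d , cd , deg-c , deg-d =
    subst (2 ≤_) (sym (tailCount≡∑ G Δ 2)) (2≤∑ c≢d (in-tail deg-c) (in-tail deg-d))
    where
    2≢Δ : 2 ≢ Δ
    2≢Δ 2≡Δ with trans (sym cd) (core-vertices-adjacent (Is2Tree⇒undirected T) bicentral c≢d
                                   (trans deg-c 2≡Δ) (trans deg-d 2≡Δ))
    ... | ()
    in-tail : ∀ {v} → deg G v ≡ 2 → 1 ≤ inTail Δ 2 (deg G v)
    in-tail deg-v =
      ≤-reflexive (sym (inTail-yes Δ (λ deg-v≡Δ → 2≢Δ (trans (sym deg-v) deg-v≡Δ)) deg-v))

degree-equation⇒Δ+Δ : ∀ {Δ x y} → Δ * 2 + 3 * x + 2 * y + 6 ≡ 4 * (2 + x + y) →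
                      Δ + Δ ≡ 2 + x + (y + y)
degree-equation⇒Δ+Δ {Δ} {x} {y} degrees =
  +-cancelʳ-≡ (3 * x + 2 * y + 6) (Δ + Δ) (2 + x + (y + y)) (begin
    Δ + Δ + (3 * x + 2 * y + 6)            ≡⟨ solve (Δ ∷ x ∷ y ∷ []) ⟩
    Δ * 2 + 3 * x + 2 * y + 6              ≡⟨ degrees ⟩
    4 * (2 + x + y)                        ≡⟨ solve (x ∷ y ∷ []) ⟩
    2 + x + (y + y) + (3 * x + 2 * y + 6)  ∎)
  where open ≡-Reasoning

Δ+Δ⇒y<Δ : ∀ {Δ x y} → Δ + Δ ≡ 2 + x + (y + y) → y < Δ
Δ+Δ⇒y<Δ {Δ} {x} {y} ΔΔ = ≮⇒≥ λ Δ<1+y → <-irrefl refl (begin-strict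
  Δ + Δ            <⟨ +-mono-< Δ<1+y Δ<1+y ⟩
  1 + y + (1 + y)  ≡⟨ solve (y ∷ []) ⟩
  2 + (y + y)      ≤⟨ +-monoˡ-≤ (y + y) (m≤m+n 2 x) ⟩
  2 + x + (y + y)  ≡⟨ ΔΔ ⟨
  Δ + Δ            ∎)
  where open ≤-Reasoning

Δ+Δ⇒halves : ∀ {Δ x y} → Δ + Δ ≡ 2 + x + (y + y) → ∃[ h ] x ≡ h + h × Δ ≡ 1 + h + y
Δ+Δ⇒halves {Δ} {x} {y} ΔΔ with m≤n⇒∃[o]m+o≡n (Δ+Δ⇒y<Δ {x = x} ΔΔ)
... | h , 1+y+h≡Δ = h , x≡h+h , trans (sym 1+y+h≡Δ) (cong suc (+-comm y h))
  where
  open ≡-Reasoning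
  x≡h+h : x ≡ h + h
  x≡h+h = +-cancelʳ-≡ (2 + (y + y)) x (h + h) (begin
    x + (2 + (y + y))          ≡⟨ solve (x ∷ y ∷ []) ⟩
    2 + x + (y + y)            ≡⟨ ΔΔ ⟨
    Δ + Δ                      ≡⟨ cong₂ _+_ 1+y+h≡Δ 1+y+h≡Δ ⟨
    1 + y + h + (1 + y + h)    ≡⟨ solve (h ∷ y ∷ []) ⟩
    h + h + (2 + (y + y))      ∎)

TailCensus : ℕ → ℕ → ℕ → ℕ → Set
TailCensus n Δ x y = (⌈ (n + 2) /2⌉ ≤ Δ × Δ ≤ n ∸ 1) × (x ≡ 2 * (n ∸ 1 ∸ Δ) × y ≡ 2 * Δ ∸ n)

tailCensus-by-halves : ∀ h y → 2 ≤ y → TailCensus (2 + (h + h) + y) (1 + h + y) (h + h) y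
tailCensus-by-halves h y 2≤y = (lower , upper) , (x-formula , y-formula)
  where
  open ≡-Reasoning
  n Δ : ℕ
  n = 2 + (h + h) + y
  Δ = 1 + h + y
  n+y≡Δ+Δ : 2 + (h + h) + y + y ≡ 1 + h + y + (1 + h + y)
  n+y≡Δ+Δ = solve (h ∷ y ∷ [])
  n∸1≡h+Δ : 1 + (h + h) + y ≡ h + (1 + h + y)
  n∸1≡h+Δ = solve (h ∷ y ∷ [])
  2Δ≡y+n : 2 * (1 + h + y) ≡ y + (2 + (h + h) + y)
  2Δ≡y+n = solve (h ∷ y ∷ [])
  lower : ⌈ (n + 2) /2⌉ ≤ Δ
  lower = ≤-trans (⌈n/2⌉-mono (≤-trans (+-monoʳ-≤ n 2≤y) (≤-reflexive n+y≡Δ+Δ)))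
                  (≤-reflexive (sym (n≡⌈n+n/2⌉ Δ)))
  upper : Δ ≤ n ∸ 1
  upper = s≤s (+-monoˡ-≤ y (m≤m+n h h))
  x-formula : h + h ≡ 2 * (n ∸ 1 ∸ Δ)
  x-formula = begin
    h + h            ≡⟨ cong (h +_) (+-identityʳ h) ⟨
    2 * h            ≡⟨ cong (2 *_) (m+n∸n≡m h Δ) ⟨
    2 * (h + Δ ∸ Δ)  ≡⟨ cong (λ m → 2 * (m ∸ Δ)) n∸1≡h+Δ ⟨
    2 * (n ∸ 1 ∸ Δ)  ∎
  y-formula : y ≡ 2 * Δ ∸ n
  y-formula = begin
    y          ≡⟨ m+n∸n≡m y n ⟨
    y + n ∸ n  ≡⟨ cong (_∸ n) 2Δ≡y+n ⟨
    2 * Δ ∸ n  ∎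

tailCensus-from-counts : ∀ {n Δ x y} → n ≡ 2 + x + y → Δ * 2 + 3 * x + 2 * y + 6 ≡ 4 * n → 2 ≤ y →
  TailCensus n Δ x y
tailCensus-from-counts {Δ = Δ} {x} {y} refl degrees 2≤y =
  by-halves (Δ+Δ⇒halves (degree-equation⇒Δ+Δ {Δ} {x} {y} degrees))
  where
  by-halves : ∃[ h ] x ≡ h + h × Δ ≡ 1 + h + y → TailCensus (2 + x + y) Δ x y
  by-halves (h , refl , refl) = tailCensus-by-halves h y 2≤y

corollary4p2 : (n : ℕ) (G : Graph n) (Δ : ℕ) → Is2Tree n G → 4 ≤ n →
    StrongBicentral G Δ → TailSet23 G Δ →
    (⌈ (n + 2) /2⌉ ≤ Δ × Δ ≤ n ∸ 1) ×
    (tailCount G Δ 3 ≡ 2 * (n ∸ 1 ∸ Δ) × tailCount G Δ 2 ≡ 2 * Δ ∸ n)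
corollary4p2 n G Δ T 4≤n bicentral tails =
  tailCensus-from-counts (vertex-count bicentral tails) degrees (2≤tailCount-2 T 4≤n bicentral)
  where
  degrees : Δ * 2 + 3 * tailCount G Δ 3 + 2 * tailCount G Δ 2 + 6 ≡ 4 * n
  degrees = trans (cong (_+ 6) (sym (degree-sum bicentral tails))) (Is2Tree⇒degree-sum T)
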